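{- Let $P$ be a set partition of $[n]$ whose standard representation is $\{(i_1,j_1),\dots,(i_t,j_t)\}$ with $i_r<j_r$ for all $r$ and $j_1<\cdots<j_t$, let $\alpha(P)=i_1i_2\cdots i_t$, and let $\lambda$ be the shape of $\alpha(P)$, i.e. the common shape of the insertion and recording tableaux obtained by applying the RSK algorithm to $\alpha(P)$. Then for every $r\ge1$, \[ \mathrm{ne}_r(P)=\lambda'_1+\lambda'_2+\cdots+\lambda'_r, \] where $\lambda'$ is the conjugate partition of $\lambda$ (with $\lambda'_i=0$ for $i$ beyond its length).
   Context: For a set partition $P$ of $[n]$, its standard representation is the set of arcs $(a,b)$, $a<b$, joining consecutive elements (in numerical order) of each block. Let $\mathrm{Ne}(P)$ be the graph whose vertices are the arcs of the standard representation, two arcs $(a,b)$ and $(c,d)$ being adjacent iff $a<c<d<b$ or $c<a<b<d$. $\mathrm{ne}_r(P)$ is the maximal number of vertices in a union of $r$ cliques of $\mathrm{Ne}(P)$, i.e. the maximal number of arcs in a union of $r$ nestings of $P$ (a nesting being a set of arcs pairwise nested, single arcs included). -}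

module Defs where

open import Data.Nat using (ℕ; zero; suc; _+_; _∸_; _≤_; _<_; _<ᵇ_; _≡ᵇ_; _≤?_)
open import Data.Bool using (Bool; true; false; _∧_; not; if_then_else_; T?)
open import Data.List using (List; []; _∷_; map; filter; concatMap; length; upTo; foldl; allFin)
open import Data.Bool.ListAction using (all; any)
open import Data.Nat.ListAction using (sum)
open import Data.Fin using (Fin)
open import Data.Sum using (_⊎_)
open import Data.Maybe using (Maybe; just; nothing)
open import Data.Product using (_×_; _,_; proj₁; Σ)
open import Relation.Binary.PropositionalEquality using (_≡_; _≢_)
open import Relation.Nullary.Decidable using (does)

-- A set partition of [n] is given by a block labelling f : ℕ → ℕ; the
-- blocks are the nonempty sets { x ∈ [n] | f x ≡ c }.  Every set
-- partition of [n] arises this way; values of f outside [n] are ignored.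

_≤ᵇ_ : ℕ → ℕ → Bool
x ≤ᵇ y = does (x ≤? y)

range : ℕ → ℕ → List ℕ
range lo hi = map (lo +_) (upTo (suc hi ∸ lo))

-- (a , b) is an arc of the standard representation: 1 ≤ a < b ≤ n,
-- a and b lie in the same block, and no element strictly between them
-- lies in that block (a, b are consecutive elements of the block).
isArc : ℕ → (ℕ → ℕ) → ℕ → ℕ → Bool
isArc n f a b =
  (1 ≤ᵇ a) ∧ (a <ᵇ b) ∧ (b ≤ᵇ n) ∧ (f a ≡ᵇ f b)
  ∧ all (λ c → not (f c ≡ᵇ f a)) (range (suc a) (b ∸ 1))

IsArc : ℕ → (ℕ → ℕ) → ℕ × ℕ → Set
IsArc n f (a , b) = isArc n f a b ≡ true

-- The arcs of the standard representation, listed in increasing order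
-- of right endpoint j_1 < j_2 < ⋯ (each b is the right endpoint of at
-- most one arc).
arcs : ℕ → (ℕ → ℕ) → List (ℕ × ℕ)
arcs n f = concatMap (λ b → map (λ a → (a , b)) (filter (λ a → T? (isArc n f a b)) (range 1 n))) (range 1 n)

alpha : ℕ → (ℕ → ℕ) → List ℕ
alpha n f = map proj₁ (arcs n f)

-- RSK (row insertion).  A tableau is a list of rows (top row first).

insertRow : ℕ → List ℕ → Maybe ℕ × List ℕ
insertRow x [] = nothing , x ∷ []
insertRow x (y ∷ ys) with x <ᵇ y
... | true  = just y , x ∷ ys
... | false with insertRow x ys
...   | (m , ys') = m , y ∷ ys'

insertT : ℕ → List (List ℕ) → List (List ℕ)
insertT x [] = (x ∷ []) ∷ []
insertT x (row ∷ rows) with insertRow x row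
... | (nothing , row') = row' ∷ rows
... | (just y  , row') = row' ∷ insertT y rows

insertionTableau : List ℕ → List (List ℕ)
insertionTableau w = foldl (λ T x → insertT x T) [] w

-- Shape λ = (λ_1, λ_2, …) of the RSK tableaux of a word (the insertion
-- and recording tableaux have the same shape).
shape : List ℕ → List ℕ
shape w = map length (insertionTableau w)

conj : List ℕ → ℕ → ℕ
conj lam k = length (filter (λ x → k ≤? x) lam)

conjSum : List ℕ → ℕ → ℕ
conjSum lam r = sum (map (conj lam) (range 1 r))

Nested : ℕ × ℕ → ℕ × ℕ → Set
Nested (a , b) (c , d) = (a < c × c < d × d < b) ⊎ (c < a × a < b × b < d)

Family : ℕ → Set
Family r = Fin r → ℕ × ℕ → Bool

IsNestingFamily : ℕ → (ℕ → ℕ) → (r : ℕ) → Family r → Set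
IsNestingFamily n f r S =
  ∀ (i : Fin r) (e e' : ℕ × ℕ) → IsArc n f e → IsArc n f e' →
  S i e ≡ true → S i e' ≡ true → e ≢ e' → Nested e e'

unionSize : ℕ → (ℕ → ℕ) → (r : ℕ) → Family r → ℕ
unionSize n f r S = length (filter (λ e → T? (any (λ i → S i e) (allFin r))) (arcs n f))

IsNe : ℕ → (ℕ → ℕ) → ℕ → ℕ → Set
IsNe n f r m =
  Σ (Family r) (λ S → IsNestingFamily n f r S × unionSize n f r S ≡ m)
  × (∀ (S : Family r) → IsNestingFamily n f r S → unionSize n f r S ≤ m)

-- Colour the letters of a word with colours 1, …, r, or leave them uncoloured, so that every colour
-- class is strictly decreasing. The arcs of P are listed by right endpoint, so two arcs nest exactly
-- when the later one has the smaller left endpoint: the families of r nestings of P are the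
-- r-colourings of α(P), and ne_r(P) is the largest number of coloured letters. By Greene's theorem
-- this number is Σᵢ min(r, λᵢ) = λ'₁ + ⋯ + λ'ᵣ. Indeed, Knuth moves carry r-colourings of a word to
-- r-colourings of the same size of the moved word, the reading word of the insertion tableau is
-- Knuth equivalent to the word, and in a reading word each (weakly increasing) row holds at most
-- min(r, λᵢ) coloured letters, a bound attained by colouring the tableau by columns.

module Submission where

open import Defs

open import Data.Bool using (Bool; true; false; T)
open import Data.Bool.ListAction using (any)
open import Data.Bool.Properties using (T-∧; T-≡)
open import Data.Empty using (⊥; ⊥-elim)
open import Data.Fin using (toℕ; fromℕ<)
import Data.Fin.Properties as Fin
open import Data.Fin.Properties using (toℕ<n; toℕ-injective; toℕ-fromℕ<)
open import Data.List using (List; []; _∷_; _++_; map; foldl; length; filter; upTo; applyUpTo; allFin)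
open import Data.List.Membership.Propositional using (_∈_; lose)
open import Data.List.Membership.Propositional.Properties using (∈-allFin; ∈-AllPairs₂)
open import Data.List.Properties
  using (∷-injective; ++-assoc; ++-identityʳ; map-++; map-∘; map-cong; map-cong-local; map-applyUpTo; length-map)
open import Data.List.Relation.Binary.Prefix.Heterogeneous using (Prefix; []; _∷_)
import Data.List.Relation.Binary.Prefix.Heterogeneous.Properties as Prefix
open import Data.List.Relation.Unary.All as All using (All; []; _∷_)
import Data.List.Relation.Unary.All.Properties as All
open import Data.List.Relation.Unary.AllPairs as AllPairs using (AllPairs; []; _∷_)
import Data.List.Relation.Unary.AllPairs.Properties as AllPairs
import Data.List.Relation.Unary.Any as Any
open import Data.List.Relation.Unary.Any.Properties using (any⁺; any⁻)
open import Data.List.Relation.Unary.Linked as Linked using (Linked; []; [-]; _∷_)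
import Data.List.Relation.Unary.Linked.Properties as Linked
open import Data.Maybe using (Maybe; just; nothing)
open import Data.Nat using (ℕ; zero; suc; _+_; _⊓_; _≤_; _<_; _>_; _<ᵇ_; _≡ᵇ_; z≤n; s≤s; _≟_)
import Data.Nat as Nat
open import Data.Nat.ListAction using (sum)
open import Data.Nat.Properties
open import Algebra.Properties.CommutativeSemigroup +-commutativeSemigroup using (x∙yz≈y∙xz; interchange)
open import Data.Product using (_×_; _,_; proj₁; proj₂; Σ; ∃; ∃₂; map₂; uncurry)
open import Data.Product.Properties using (≡-dec)
open import Data.Sum as Sum using (_⊎_; inj₁; inj₂)
open import Data.Unit using (tt)
open import Function using (id; flip)
open import Function.Bundles using (Equivalence; _⇔_; mk⇔)
open import Level using (0ℓ)
open import Relation.Binary.Construct.Closure.Equivalence as EqClosure using (EqClosure)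
open import Relation.Binary.Core using (Rel)
open import Relation.Binary.Definitions using (DecidableEquality)
open import Relation.Binary.PropositionalEquality
import Relation.Binary.Reasoning.Setoid as SetoidReasoning
open import Relation.Binary.Structures using (IsEquivalence)
open import Relation.Nullary using (¬_; yes; no)
open import Relation.Nullary.Decidable using (T?)

ColouredWord : Set
ColouredWord = List (ℕ × ℕ)

letters : ColouredWord → List ℕ
letters = map proj₁

weight : ℕ → ℕ
weight zero    = 0
weight (suc _) = 1

count : ColouredWord → ℕ
count []             = 0
count ((_ , c) ∷ cw) = weight c + count cw

-- Colour 0 means uncoloured; every other colour class has to be strictly decreasing.
infix 4 _↘_
_↘_ : ℕ × ℕ → ℕ × ℕ → Set
(v , c) ↘ (v' , c') = c ≢ 0 → c ≡ c' → v' < v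

↘-different : ∀ {v c v' c'} → c ≢ c' → (v , c) ↘ (v' , c')
↘-different c≢c' _ c≡c' = ⊥-elim (c≢c' c≡c')

↘-from-uncoloured : ∀ {v} e → (v , 0) ↘ e
↘-from-uncoloured _ 0≢0 = ⊥-elim (0≢0 refl)

↘-to-uncoloured : ∀ {v} e → e ↘ (v , 0)
↘-to-uncoloured (_ , c) c≢0 c≡0 = ⊥-elim (c≢0 c≡0)

Bounded : ℕ → ColouredWord → Set
Bounded r = All (λ e → proj₂ e ≤ r)

IsColouring : ℕ → ColouredWord → Set
IsColouring r cw = Bounded r cw × AllPairs _↘_ cw

HasColouring : ℕ → List ℕ → ℕ → Set
HasColouring r w k = Σ ColouredWord λ cw → IsColouring r cw × letters cw ≡ w × count cw ≡ k

MaxColouring : ℕ → List ℕ → ℕ → Set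
MaxColouring r w m = HasColouring r w m × (∀ {k} → HasColouring r w k → k ≤ m)

ColouringsTransfer : ℕ → List ℕ → List ℕ → Set
ColouringsTransfer r u v = ∀ {k} → HasColouring r u k → HasColouring r v k

count-++ : ∀ xs ys → count (xs ++ ys) ≡ count xs + count ys
count-++ []             ys = refl
count-++ ((_ , c) ∷ xs) ys = trans (cong (weight c +_) (count-++ xs ys)) (sym (+-assoc (weight c) _ _))

weight-≢0 : ∀ {c} → c ≢ 0 → weight c ≡ 1
weight-≢0 {zero}  c≢0 = ⊥-elim (c≢0 refl)
weight-≢0 {suc c} _   = refl

letters-++⁻ : ∀ p {q} (cw : ColouredWord) → letters cw ≡ p ++ q →
              ∃₂ λ cp cq → cw ≡ cp ++ cq × letters cp ≡ p × letters cq ≡ q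
letters-++⁻ []      cw              eq = [] , cw , refl , refl , eq
letters-++⁻ (v ∷ p) ((v' , c) ∷ cw) eq with ∷-injective eq
... | refl , eq' with letters-++⁻ p cw eq'
...   | cp , cq , refl , refl , eq'' = (v , c) ∷ cp , cq , refl , refl , eq''

-- Knuth equivalence

data KnuthMove : Rel (List ℕ) 0ℓ where
  knuth₁ : ∀ p s {x y z} → x < y → y ≤ z → KnuthMove (p ++ y ∷ z ∷ x ∷ s) (p ++ y ∷ x ∷ z ∷ s)
  knuth₂ : ∀ p s {x y z} → x ≤ y → y < z → KnuthMove (p ++ x ∷ z ∷ y ∷ s) (p ++ z ∷ x ∷ y ∷ s)

infix 4 _≈ᴷ_
_≈ᴷ_ : Rel (List ℕ) 0ℓ
_≈ᴷ_ = EqClosure KnuthMove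

knuthMove : ∀ {u v} → KnuthMove u v → u ≈ᴷ v
knuthMove = EqClosure.return

≈ᴷ-refl : ∀ {w} → w ≈ᴷ w
≈ᴷ-refl = EqClosure.reflexive KnuthMove

module ≈ᴷ-Reasoning = SetoidReasoning (EqClosure.setoid KnuthMove)

-- Knuth moves transfer colourings

-- What cq' needs to take the place of the suffix cq of an r-colouring without changing its size.
record Replaces (r : ℕ) (cq' cq : ColouredWord) : Set where
  field
    isColouring : IsColouring r cq'
    count-≡     : count cq' ≡ count cq
    ↘-all       : ∀ {e} → All (e ↘_) cq → All (e ↘_) cq'

AllPairs-++⁻ : ∀ {A : Set} {R : Rel A 0ℓ} xs {ys} → AllPairs R (xs ++ ys) → AllPairs R xs × AllPairs R ys
AllPairs-++⁻ []       ps       = [] , ps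
AllPairs-++⁻ (_ ∷ xs) (p ∷ ps) with AllPairs-++⁻ xs ps
... | pxs , pys = All.++⁻ˡ xs p ∷ pxs , pys

isColouring-++⁻ : ∀ {r} cp {cq} → IsColouring r (cp ++ cq) → IsColouring r cp × IsColouring r cq
isColouring-++⁻ cp (bs , ps) with AllPairs-++⁻ cp ps
... | pcp , pcq = (All.++⁻ˡ cp bs , pcp) , (All.++⁻ʳ cp bs , pcq)

replaces-∷ : ∀ {r v c cq cq'} → IsColouring r ((v , c) ∷ cq) → Replaces r cq' cq →
             Replaces r ((v , c) ∷ cq') ((v , c) ∷ cq)
replaces-∷ {c = c} (b ∷ _ , p ∷ _) rep = record
  { isColouring = b ∷ proj₁ isColouring , ↘-all p ∷ proj₂ isColouring
  ; count-≡     = cong (weight c +_) count-≡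
  ; ↘-all       = λ { (q ∷ qs) → q ∷ ↘-all qs }
  }
  where open Replaces rep

replaces-++ : ∀ {r cq cq'} cp → IsColouring r (cp ++ cq) → Replaces r cq' cq →
              Replaces r (cp ++ cq') (cp ++ cq)
replaces-++ []             _                     rep = rep
replaces-++ ((v , c) ∷ cp) col@(_ ∷ bs , _ ∷ ps) rep = replaces-∷ col (replaces-++ cp (bs , ps) rep)

WindowTransfer : ℕ → List ℕ → List ℕ → Set
WindowTransfer r u v = ∀ {s} cq → IsColouring r cq → letters cq ≡ u ++ s →
                       Σ ColouredWord λ cq' → letters cq' ≡ v ++ s × Replaces r cq' cq

transfer-in-context : ∀ {r u v} → WindowTransfer r u v → ∀ p s →
                      ColouringsTransfer r (p ++ u ++ s) (p ++ v ++ s)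
transfer-in-context window p s (cw , col , eq , refl) with letters-++⁻ p cw eq
... | cp , cq , refl , refl , eq' with window cq (proj₂ (isColouring-++⁻ cp col)) eq'
...   | cq' , eq'' , rep =
  cp ++ cq' , Replaces.isColouring rep' , trans (map-++ proj₁ cp cq') (cong (letters cp ++_) eq'') ,
  Replaces.count-≡ rep'
  where
  rep' = replaces-++ cp col rep

swap₁₂ : ∀ {r v₁ c₁ v₂ c₂ cs} → IsColouring r ((v₁ , c₁) ∷ (v₂ , c₂) ∷ cs) →
         (v₂ , c₂) ↘ (v₁ , c₁) →
         Replaces r ((v₂ , c₂) ∷ (v₁ , c₁) ∷ cs) ((v₁ , c₁) ∷ (v₂ , c₂) ∷ cs)
swap₁₂ {c₁ = c₁} {c₂ = c₂} {cs} (b₁ ∷ b₂ ∷ bs , (_ ∷ p₁s) ∷ p₂s ∷ ps) new = record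
  { isColouring = b₂ ∷ b₁ ∷ bs , (new ∷ p₂s) ∷ p₁s ∷ ps
  ; count-≡     = x∙yz≈y∙xz (weight c₂) (weight c₁) (count cs)
  ; ↘-all       = λ { (q₁ ∷ q₂ ∷ qs) → q₂ ∷ q₁ ∷ qs }
  }

swap₂₃ : ∀ {r v₁ c₁ v₂ c₂ v₃ c₃ cs} → IsColouring r ((v₁ , c₁) ∷ (v₂ , c₂) ∷ (v₃ , c₃) ∷ cs) →
         (v₃ , c₃) ↘ (v₂ , c₂) →
         Replaces r ((v₁ , c₁) ∷ (v₃ , c₃) ∷ (v₂ , c₂) ∷ cs)
                    ((v₁ , c₁) ∷ (v₂ , c₂) ∷ (v₃ , c₃) ∷ cs)
swap₂₃ col@(_ ∷ bs , _ ∷ ps) new = replaces-∷ col (swap₁₂ (bs , ps) new)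

swapColour : ℕ → ℕ → ℕ → ℕ
swapColour k m d with d ≟ k | d ≟ m
... | yes _ | _     = m
... | no _  | yes _ = k
... | no _  | no _  = d

data SwapView (k m d : ℕ) : ℕ → Set where
  was-k : d ≡ k → SwapView k m d m
  was-m : d ≢ k → d ≡ m → SwapView k m d k
  other : d ≢ k → d ≢ m → SwapView k m d d

swapView : ∀ k m d → SwapView k m d (swapColour k m d)
swapView k m d with d ≟ k | d ≟ m
... | yes d≡k | _       = was-k d≡k
... | no d≢k  | yes d≡m = was-m d≢k d≡m
... | no d≢k  | no d≢m  = other d≢k d≢m

swapColour-injective : ∀ k m {d d'} → swapColour k m d ≡ swapColour k m d' → d ≡ d'
swapColour-injective k m {d} {d'} eq
  with swapColour k m d | swapView k m d | swapColour k m d' | swapView k m d'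
... | _ | was-k p     | _ | was-k p'      = trans p (sym p')
... | _ | was-k _     | _ | was-m n' q'   = ⊥-elim (n' (trans q' eq))
... | _ | was-k _     | _ | other _ n'    = ⊥-elim (n' (sym eq))
... | _ | was-m n q   | _ | was-k _       = ⊥-elim (n (trans q (sym eq)))
... | _ | was-m _ q   | _ | was-m _ q'    = trans q (sym q')
... | _ | was-m _ _   | _ | other n' _    = ⊥-elim (n' (sym eq))
... | _ | other _ n   | _ | was-k _       = ⊥-elim (n eq)
... | _ | other n _   | _ | was-m _ _     = ⊥-elim (n eq)
... | _ | other _ _   | _ | other _ _     = eq

swapColour-zero : ∀ {k m} → k ≢ 0 → m ≢ 0 → swapColour k m 0 ≡ 0
swapColour-zero {k} {m} k≢0 m≢0 with swapColour k m 0 | swapView k m 0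
... | _ | was-k 0≡k   = ⊥-elim (k≢0 (sym 0≡k))
... | _ | was-m _ 0≡m = ⊥-elim (m≢0 (sym 0≡m))
... | _ | other _ _   = refl

weight-swapColour : ∀ {k m} → k ≢ 0 → m ≢ 0 → ∀ d → weight (swapColour k m d) ≡ weight d
weight-swapColour k≢0 m≢0 zero = cong weight (swapColour-zero k≢0 m≢0)
weight-swapColour {k} {m} k≢0 m≢0 (suc d) with swapColour k m (suc d) | swapView k m (suc d)
... | _ | was-k _   = weight-≢0 m≢0
... | _ | was-m _ _ = weight-≢0 k≢0
... | _ | other _ _ = refl

swapColours : ℕ → ℕ → ColouredWord → ColouredWord
swapColours k m = map (map₂ (swapColour k m))

letters-swapColours : ∀ k m cs → letters (swapColours k m cs) ≡ letters cs
letters-swapColours k m cs = sym (map-∘ cs)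

count-swapColours : ∀ {k m} → k ≢ 0 → m ≢ 0 → ∀ cs → count (swapColours k m cs) ≡ count cs
count-swapColours k≢0 m≢0 []            = refl
count-swapColours k≢0 m≢0 ((_ , d) ∷ cs) =
  cong₂ _+_ (weight-swapColour k≢0 m≢0 d) (count-swapColours k≢0 m≢0 cs)

swapColours-bounded : ∀ {r k m} → k ≤ r → m ≤ r → ∀ {cs} → Bounded r cs →
                      Bounded r (swapColours k m cs)
swapColours-bounded {r} {k} {m} k≤r m≤r bs = All.map⁺ (All.map bound bs)
  where
  bound : ∀ {d} → d ≤ r → swapColour k m d ≤ r
  bound {d} d≤r with swapColour k m d | swapView k m d
  ... | _ | was-k _   = m≤r
  ... | _ | was-m _ _ = k≤r
  ... | _ | other _ _ = d≤r

All-swapColours : ∀ {k m} {P Q : ℕ × ℕ → Set} → (∀ {v d} → P (v , d) → Q (v , swapColour k m d)) →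
                  ∀ {cs} → All P cs → All Q (swapColours k m cs)
All-swapColours f ps = All.map⁺ (All.map (λ { {_ , _} → f }) ps)

swapColours-colouring : ∀ {k m} → k ≢ 0 → m ≢ 0 → ∀ {cs} → AllPairs _↘_ cs →
                        AllPairs _↘_ (swapColours k m cs)
swapColours-colouring {k} {m} k≢0 m≢0 ps = AllPairs.map⁺ (AllPairs.map swapped ps)
  where
  swapped : ∀ {e e'} → e ↘ e' → map₂ (swapColour k m) e ↘ map₂ (swapColour k m) e'
  swapped {_ , c} h sc≢0 sc≡sc' =
    h (λ c≡0 → sc≢0 (trans (cong (swapColour k m) c≡0) (swapColour-zero k≢0 m≢0)))
      (swapColour-injective k m sc≡sc')

-- The moves yzx ↦ yxz (x < y ≤ z) and zxy ↦ xzy (x ≤ y < z) can only break a colour class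
-- containing both z and x. That class is rerouted through y: directly if y is uncoloured, and
-- otherwise by exchanging the colours of x and y on the rest of the word.
module _ {r x y z : ℕ} {cs : ColouredWord} where

  knuth₁-recolour : ∀ {b} → x < y → y ≤ z → b ≢ 0 →
                    IsColouring r ((y , 0) ∷ (z , b) ∷ (x , b) ∷ cs) →
                    Replaces r ((y , b) ∷ (x , b) ∷ (z , 0) ∷ cs) ((y , 0) ∷ (z , b) ∷ (x , b) ∷ cs)
  knuth₁-recolour x<y y≤z b≢0 (_ ∷ bz ∷ _ ∷ bs , _ ∷ _ ∷ pxs ∷ ps) = record
    { isColouring = bz ∷ bz ∷ z≤n ∷ bs ,
                    ((λ _ _ → x<y) ∷ ↘-to-uncoloured _
                      ∷ All.map (λ hx b≢0 b≡d → <-trans (hx b≢0 b≡d) x<y) pxs)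
                    ∷ (↘-to-uncoloured _ ∷ pxs)
                    ∷ All.universal ↘-from-uncoloured cs
                    ∷ ps
    ; count-≡     = refl
    ; ↘-all       = λ { (_ ∷ qz ∷ qx ∷ qs) →
                      (λ c≢0 c≡b → ≤-<-trans y≤z (qz c≢0 c≡b)) ∷ qx ∷ ↘-to-uncoloured _ ∷ qs }
    }

  knuth₂-recolour : ∀ {a} → x ≤ y → y < z → a ≢ 0 →
                    IsColouring r ((z , a) ∷ (x , a) ∷ (y , 0) ∷ cs) →
                    Replaces r ((x , 0) ∷ (z , a) ∷ (y , a) ∷ cs) ((z , a) ∷ (x , a) ∷ (y , 0) ∷ cs)
  knuth₂-recolour x≤y y<z a≢0 (bz ∷ _ ∷ _ ∷ bs , _ ∷ (_ ∷ pxs) ∷ _ ∷ ps) = record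
    { isColouring = z≤n ∷ bz ∷ bz ∷ bs ,
                    All.universal ↘-from-uncoloured _
                    ∷ ((λ _ _ → y<z)
                       ∷ All.map (λ hx a≢0 a≡d → <-trans (<-≤-trans (hx a≢0 a≡d) x≤y) y<z) pxs)
                    ∷ All.map (λ hx a≢0 a≡d → <-≤-trans (hx a≢0 a≡d) x≤y) pxs
                    ∷ ps
    ; count-≡     = refl
    ; ↘-all       = λ { (qz ∷ _ ∷ _ ∷ qs) →
                      ↘-to-uncoloured _ ∷ qz ∷ (λ c≢0 c≡a → <-trans y<z (qz c≢0 c≡a)) ∷ qs }
    }

  knuth₁-swapColours : ∀ {a b} → x < y → y ≤ z → a ≢ 0 → b ≢ 0 →
                       IsColouring r ((y , a) ∷ (z , b) ∷ (x , b) ∷ cs) →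
                       Replaces r ((y , a) ∷ (x , a) ∷ (z , b) ∷ swapColours b a cs)
                                  ((y , a) ∷ (z , b) ∷ (x , b) ∷ cs)
  knuth₁-swapColours {a} {b} x<y y≤z a≢0 b≢0
                     (by ∷ bz ∷ _ ∷ bs , (pyz ∷ _ ∷ pys) ∷ _ ∷ pxs ∷ ps) = record
    { isColouring = by ∷ by ∷ bz ∷ swapColours-bounded bz by bs ,
                    ((λ _ _ → x<y) ∷ ↘-different a≢b ∷ All-swapColours below-y (All.zip (pxs , pys)))
                    ∷ (↘-different a≢b ∷ All-swapColours below-x pxs)
                    ∷ All-swapColours below-z pys
                    ∷ swapColours-colouring b≢0 a≢0 ps
    ; count-≡     = count-eq
    ; ↘-all       = λ { (qy ∷ qz ∷ _ ∷ qs) →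
                      qy ∷ (λ c≢0 c≡a → <-trans x<y (qy c≢0 c≡a)) ∷ qz
                      ∷ All-swapColours (below qy qz) (All.zip (pxs , All.zip (pys , qs))) }
    }
    where
    a≢b : a ≢ b
    a≢b a≡b = <⇒≱ (pyz a≢0 a≡b) y≤z

    below-y : ∀ {v d} → (x , b) ↘ (v , d) × (y , a) ↘ (v , d) → (y , a) ↘ (v , swapColour b a d)
    below-y {v} {d} (hx , hy) with swapColour b a d | swapView b a d
    ... | _ | was-k d≡b = λ _ _ → <-trans (hx b≢0 (sym d≡b)) x<y
    ... | _ | was-m _ _ = ↘-different a≢b
    ... | _ | other _ _ = hy

    below-x : ∀ {v d} → (x , b) ↘ (v , d) → (x , a) ↘ (v , swapColour b a d)
    below-x {v} {d} hx with swapColour b a d | swapView b a d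
    ... | _ | was-k d≡b   = λ _ _ → hx b≢0 (sym d≡b)
    ... | _ | was-m _ _   = ↘-different a≢b
    ... | _ | other _ d≢a = ↘-different (≢-sym d≢a)

    below-z : ∀ {v d} → (y , a) ↘ (v , d) → (z , b) ↘ (v , swapColour b a d)
    below-z {v} {d} hy with swapColour b a d | swapView b a d
    ... | _ | was-k _     = ↘-different (≢-sym a≢b)
    ... | _ | was-m _ d≡a = λ _ _ → <-≤-trans (hy a≢0 (sym d≡a)) y≤z
    ... | _ | other d≢b _ = ↘-different (≢-sym d≢b)

    below : ∀ {e} → e ↘ (y , a) → e ↘ (z , b) →
            ∀ {v d} → (x , b) ↘ (v , d) × (y , a) ↘ (v , d) × e ↘ (v , d) → e ↘ (v , swapColour b a d)
    below {_ , c} qy qz {v} {d} (hx , hy , he) with swapColour b a d | swapView b a d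
    ... | _ | was-k d≡b   = λ c≢0 c≡a → <-trans (<-trans (hx b≢0 (sym d≡b)) x<y) (qy c≢0 c≡a)
    ... | _ | was-m _ d≡a = λ c≢0 c≡b → <-trans (<-≤-trans (hy a≢0 (sym d≡a)) y≤z) (qz c≢0 c≡b)
    ... | _ | other _ _   = he

    count-eq : weight a + (weight a + (weight b + count (swapColours b a cs))) ≡
               weight a + (weight b + (weight b + count cs))
    count-eq rewrite weight-≢0 a≢0 | weight-≢0 b≢0 | count-swapColours b≢0 a≢0 cs = refl

  knuth₂-swapColours : ∀ {a c} → x ≤ y → y < z → a ≢ 0 → c ≢ 0 →
                       IsColouring r ((z , a) ∷ (x , a) ∷ (y , c) ∷ cs) →
                       Replaces r ((x , c) ∷ (z , a) ∷ (y , a) ∷ swapColours a c cs)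
                                  ((z , a) ∷ (x , a) ∷ (y , c) ∷ cs)
  knuth₂-swapColours {a} {c} x≤y y<z a≢0 c≢0
                     (bz ∷ _ ∷ by ∷ bs , _ ∷ (pxy ∷ pxs) ∷ pys ∷ ps) = record
    { isColouring = by ∷ bz ∷ bz ∷ swapColours-bounded bz by bs ,
                    (↘-different (≢-sym a≢c) ∷ ↘-different (≢-sym a≢c) ∷ All-swapColours below-x pxs)
                    ∷ ((λ _ _ → y<z) ∷ All-swapColours below-z pys)
                    ∷ All-swapColours below-y pys
                    ∷ swapColours-colouring a≢0 c≢0 ps
    ; count-≡     = count-eq
    ; ↘-all       = λ { (qz ∷ _ ∷ qy ∷ qs) →
                      (λ c'≢0 c'≡c → ≤-<-trans x≤y (qy c'≢0 c'≡c)) ∷ qz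
                      ∷ (λ c'≢0 c'≡a → <-trans y<z (qz c'≢0 c'≡a))
                      ∷ All-swapColours (below qz qy) (All.zip (pxs , All.zip (pys , qs))) }
    }
    where
    a≢c : a ≢ c
    a≢c a≡c = <⇒≱ (pxy a≢0 a≡c) x≤y

    below-x : ∀ {v d} → (x , a) ↘ (v , d) → (x , c) ↘ (v , swapColour a c d)
    below-x {v} {d} hx with swapColour a c d | swapView a c d
    ... | _ | was-k d≡a   = λ _ _ → hx a≢0 (sym d≡a)
    ... | _ | was-m _ _   = ↘-different (≢-sym a≢c)
    ... | _ | other _ d≢c = ↘-different (≢-sym d≢c)

    below-z : ∀ {v d} → (y , c) ↘ (v , d) → (z , a) ↘ (v , swapColour a c d)
    below-z {v} {d} hy with swapColour a c d | swapView a c d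
    ... | _ | was-k _     = ↘-different a≢c
    ... | _ | was-m _ d≡c = λ _ _ → <-trans (hy c≢0 (sym d≡c)) y<z
    ... | _ | other d≢a _ = ↘-different (≢-sym d≢a)

    below-y : ∀ {v d} → (y , c) ↘ (v , d) → (y , a) ↘ (v , swapColour a c d)
    below-y {v} {d} hy with swapColour a c d | swapView a c d
    ... | _ | was-k _     = ↘-different a≢c
    ... | _ | was-m _ d≡c = λ _ _ → hy c≢0 (sym d≡c)
    ... | _ | other d≢a _ = ↘-different (≢-sym d≢a)

    below : ∀ {e} → e ↘ (z , a) → e ↘ (y , c) →
            ∀ {v d} → (x , a) ↘ (v , d) × (y , c) ↘ (v , d) × e ↘ (v , d) → e ↘ (v , swapColour a c d)
    below {_ , c'} qz qy {v} {d} (hx , hy , he) with swapColour a c d | swapView a c d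
    ... | _ | was-k d≡a   = λ c'≢0 c'≡c → <-trans (<-≤-trans (hx a≢0 (sym d≡a)) x≤y) (qy c'≢0 c'≡c)
    ... | _ | was-m _ d≡c = λ c'≢0 c'≡a → <-trans (<-trans (hy c≢0 (sym d≡c)) y<z) (qz c'≢0 c'≡a)
    ... | _ | other _ _   = he

    count-eq : weight c + (weight a + (weight a + count (swapColours a c cs))) ≡
               weight a + (weight a + (weight c + count cs))
    count-eq rewrite weight-≢0 a≢0 | weight-≢0 c≢0 | count-swapColours a≢0 c≢0 cs = refl

module _ {r x y z : ℕ} where

  knuth₁-transfer : x < y → y ≤ z → WindowTransfer r (y ∷ z ∷ x ∷ []) (y ∷ x ∷ z ∷ [])
  knuth₁-transfer x<y y≤z ((_ , a) ∷ (_ , b) ∷ (_ , c) ∷ cs) col refl with b ≟ 0 | b ≟ c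
  ... | yes refl | _       = _ , refl , swap₂₃ col (↘-to-uncoloured _)
  ... | no _     | no b≢c  = _ , refl , swap₂₃ col (↘-different (≢-sym b≢c))
  ... | no b≢0   | yes refl with a ≟ 0
  ...   | yes refl = _ , refl , knuth₁-recolour x<y y≤z b≢0 col
  ...   | no a≢0   = _ , cong (λ t → y ∷ x ∷ z ∷ t) (letters-swapColours b a cs) ,
                     knuth₁-swapColours x<y y≤z a≢0 b≢0 col

  knuth₁-transfer⁻¹ : x < y → y ≤ z → WindowTransfer r (y ∷ x ∷ z ∷ []) (y ∷ z ∷ x ∷ [])
  knuth₁-transfer⁻¹ x<y y≤z (_ ∷ _ ∷ _ ∷ _) col refl =
    _ , refl , swap₂₃ col (λ _ _ → <-≤-trans x<y y≤z)

  knuth₂-transfer : x ≤ y → y < z → WindowTransfer r (z ∷ x ∷ y ∷ []) (x ∷ z ∷ y ∷ [])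
  knuth₂-transfer x≤y y<z ((_ , b) ∷ (_ , a) ∷ (_ , c) ∷ cs) col refl with a ≟ 0 | a ≟ b
  ... | yes refl | _       = _ , refl , swap₁₂ col (↘-from-uncoloured _)
  ... | no _     | no a≢b  = _ , refl , swap₁₂ col (↘-different a≢b)
  ... | no a≢0   | yes refl with c ≟ 0
  ...   | yes refl = _ , refl , knuth₂-recolour x≤y y<z a≢0 col
  ...   | no c≢0   = _ , cong (λ t → x ∷ z ∷ y ∷ t) (letters-swapColours a c cs) ,
                     knuth₂-swapColours x≤y y<z a≢0 c≢0 col

  knuth₂-transfer⁻¹ : x ≤ y → y < z → WindowTransfer r (x ∷ z ∷ y ∷ []) (z ∷ x ∷ y ∷ [])
  knuth₂-transfer⁻¹ x≤y y<z (_ ∷ _ ∷ _ ∷ _) col refl =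
    _ , refl , swap₁₂ col (λ _ _ → ≤-<-trans x≤y y<z)

ColouringsAgree : ℕ → Rel (List ℕ) 0ℓ
ColouringsAgree r u v = ColouringsTransfer r u v × ColouringsTransfer r v u

colouringsAgree-isEquivalence : ∀ r → IsEquivalence (ColouringsAgree r)
colouringsAgree-isEquivalence r = record
  { refl  = (λ h → h) , (λ h → h)
  ; sym   = λ { (u⇒v , v⇒u) → v⇒u , u⇒v }
  ; trans = λ { (u⇒v , v⇒u) (v⇒w , w⇒v) → (λ h → v⇒w (u⇒v h)) , (λ h → v⇒u (w⇒v h)) }
  }

knuthMove-colouringsAgree : ∀ {r u v} → KnuthMove u v → ColouringsAgree r u v
knuthMove-colouringsAgree (knuth₁ p s x<y y≤z) =
  transfer-in-context (knuth₁-transfer x<y y≤z) p s , transfer-in-context (knuth₁-transfer⁻¹ x<y y≤z) p s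
knuthMove-colouringsAgree (knuth₂ p s x≤y y<z) =
  transfer-in-context (knuth₂-transfer⁻¹ x≤y y<z) p s , transfer-in-context (knuth₂-transfer x≤y y<z) p s

maxColouring-≈ᴷ : ∀ {r u v m} → u ≈ᴷ v → MaxColouring r u m → MaxColouring r v m
maxColouring-≈ᴷ {r} u≈v (attained , bounded)
  with EqClosure.fold (colouringsAgree-isEquivalence r) knuthMove-colouringsAgree u≈v
... | u⇒v , v⇒u = u⇒v attained , λ h → bounded (v⇒u h)

-- Row insertion and the reading word of a tableau

data InsertRow (x : ℕ) : List ℕ → Maybe ℕ → List ℕ → Set where
  append : InsertRow x [] nothing (x ∷ [])
  bump   : ∀ {c t} → x < c → InsertRow x (c ∷ t) (just c) (x ∷ t)
  skip   : ∀ {c t m t'} → c ≤ x → InsertRow x t m t' → InsertRow x (c ∷ t) m (c ∷ t')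

insertRow-view : ∀ x row → InsertRow x row (proj₁ (insertRow x row)) (proj₂ (insertRow x row))
insertRow-view x []      = append
insertRow-view x (c ∷ t) with x <ᵇ c in x<ᵇc
... | true  = bump (<ᵇ⇒< x c (subst T (sym x<ᵇc) tt))
... | false = skip (≮⇒≥ (λ x<c → subst T x<ᵇc (<⇒<ᵇ x<c))) (insertRow-view x t)

appended : ∀ {x row row'} → InsertRow x row nothing row' → row' ≡ row ++ x ∷ []
appended append     = refl
appended (skip _ v) = cong (_ ∷_) (appended v)

bumped-> : ∀ {x row y row'} → InsertRow x row (just y) row' → x < y
bumped-> (bump x<y)  = x<y
bumped-> (skip _ v) = bumped-> v

bumped-head : ∀ {x row y row'} → InsertRow x row (just y) row' → ∃₂ λ h t → row' ≡ h ∷ t × h ≤ x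
bumped-head (bump _)     = _ , _ , refl , ≤-refl
bumped-head (skip c≤x _) = _ , _ , refl , c≤x

insertRow-All : ∀ {P : ℕ → Set} {x row m row'} → InsertRow x row m row' → All P row → P x → All P row'
insertRow-All append     []       px = px ∷ []
insertRow-All (bump _)   (_ ∷ ps) px = px ∷ ps
insertRow-All (skip _ v) (p ∷ ps) px = p ∷ insertRow-All v ps px

Sorted : List ℕ → Set
Sorted = AllPairs _≤_

insertRow-sorted : ∀ {x row m row'} → InsertRow x row m row' → Sorted row → Sorted row'
insertRow-sorted append       []       = [] ∷ []
insertRow-sorted (bump x<c)   (p ∷ ps) = All.map (≤-trans (<⇒≤ x<c)) p ∷ ps
insertRow-sorted (skip c≤x v) (p ∷ ps) = insertRow-All v p c≤x ∷ insertRow-sorted v ps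

-- The row below is no longer than the row above and strictly greater entrywise.
ColumnStrict : List ℕ → List ℕ → Set
ColumnStrict upper lower = Prefix _>_ lower upper

columnStrict-trans : ∀ {a b c} → ColumnStrict a b → ColumnStrict b c → ColumnStrict a c
columnStrict-trans a⊲b b⊲c = Prefix.trans (flip <-trans) b⊲c a⊲b

columnStrict-below : ∀ {row rows} → Linked ColumnStrict (row ∷ rows) → All (ColumnStrict row) rows
columnStrict-below [-]       = []
columnStrict-below (cs ∷ lk) = Linked.Linked⇒All columnStrict-trans cs lk

columnStrict-insert : ∀ {x u m u' l} → InsertRow x u m u' → ColumnStrict u l → ColumnStrict u' l
columnStrict-insert _            []          = []
columnStrict-insert (bump x<c)   (c<b ∷ cs) = <-trans x<c c<b ∷ cs
columnStrict-insert (skip _ v)   (c<b ∷ cs) = c<b ∷ columnStrict-insert v cs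

columnStrict-bump : ∀ {x u y u' l m l'} → ColumnStrict u l → InsertRow x u (just y) u' → InsertRow y l m l' →
                    ColumnStrict u' l'
columnStrict-bump []          (bump x<y)    append       = x<y ∷ []
columnStrict-bump (_ ∷ cs)    (bump x<y)    (bump _)     = x<y ∷ cs
columnStrict-bump (c<b ∷ _)   (bump _)      (skip b≤c _) = ⊥-elim (<⇒≱ c<b b≤c)
columnStrict-bump []          (skip c≤x v)  append       = ≤-<-trans c≤x (bumped-> v) ∷ []
columnStrict-bump (_ ∷ cs)    (skip c≤x v)  (bump _)     =
  ≤-<-trans c≤x (bumped-> v) ∷ columnStrict-insert v cs
columnStrict-bump (c<b ∷ cs)  (skip _ v)    (skip _ w)   = c<b ∷ columnStrict-bump cs v w

Tableau : List (List ℕ) → Set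
Tableau T = All Sorted T × Linked ColumnStrict T

insertT-sorted : ∀ x T → All Sorted T → All Sorted (insertT x T)
insertT-sorted x []           _          = ([] ∷ []) ∷ []
insertT-sorted x (row ∷ rows) (sr ∷ srs) with insertRow x row | insertRow-view x row
... | nothing , _ | v = insertRow-sorted v sr ∷ srs
... | just y  , _ | v = insertRow-sorted v sr ∷ insertT-sorted y rows srs

linked-insertRow : ∀ {x row m row' rows} → InsertRow x row m row' →
                   Linked ColumnStrict (row ∷ rows) → Linked ColumnStrict (row' ∷ rows)
linked-insertRow v [-]       = [-]
linked-insertRow v (cs ∷ lk) = columnStrict-insert v cs ∷ lk

linked-bump : ∀ {x row y row'} rows → InsertRow x row (just y) row' →
              Linked ColumnStrict (row ∷ rows) → Linked ColumnStrict (row' ∷ insertT y rows)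
linked-bump []            v [-]       = columnStrict-bump [] v append ∷ [-]
linked-bump {y = y} (r₂ ∷ rs) v (cs ∷ lk) with insertRow y r₂ | insertRow-view y r₂
... | nothing , _ | w = columnStrict-bump cs v w ∷ linked-insertRow w lk
... | just _  , _ | w = columnStrict-bump cs v w ∷ linked-bump rs w lk

insertT-linked : ∀ x T → Linked ColumnStrict T → Linked ColumnStrict (insertT x T)
insertT-linked x []           _  = [-]
insertT-linked x (row ∷ rows) lk with insertRow x row | insertRow-view x row
... | nothing , _ | v = linked-insertRow v lk
... | just _  , _ | v = linked-bump rows v lk

reading : List (List ℕ) → List ℕ
reading []           = []
reading (row ∷ rows) = reading rows ++ row

insertAll : List (List ℕ) → List ℕ → List (List ℕ)
insertAll = foldl (λ T x → insertT x T)

insertAll-tableau : ∀ T w → Tableau T → Tableau (insertAll T w)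
insertAll-tableau T []      tab        = tab
insertAll-tableau T (x ∷ w) (srt , lk) =
  insertAll-tableau (insertT x T) w (insertT-sorted x T srt , insertT-linked x T lk)

module _ where
  open ≈ᴷ-Reasoning

  shift-left : ∀ p s {c x} t → Sorted (c ∷ t) → x < c → p ++ c ∷ t ++ x ∷ s ≈ᴷ p ++ c ∷ x ∷ t ++ s
  shift-left p s         []      _                  _   = ≈ᴷ-refl
  shift-left p s {c} {x} (d ∷ t) ((c≤d ∷ _) ∷ srt) x<c = begin
    p ++ c ∷ d ∷ t ++ x ∷ s          ≡⟨ ++-assoc p (c ∷ []) _ ⟨
    (p ++ c ∷ []) ++ d ∷ t ++ x ∷ s  ≈⟨ shift-left (p ++ c ∷ []) s t srt (<-≤-trans x<c c≤d) ⟩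
    (p ++ c ∷ []) ++ d ∷ x ∷ t ++ s  ≡⟨ ++-assoc p (c ∷ []) _ ⟩
    p ++ c ∷ d ∷ x ∷ t ++ s          ≈⟨ knuthMove (knuth₁ p (t ++ s) x<c c≤d) ⟩
    p ++ c ∷ x ∷ d ∷ t ++ s          ∎

  bump-knuth : ∀ p s {x row y row'} → Sorted row → InsertRow x row (just y) row' →
               p ++ row ++ x ∷ s ≈ᴷ p ++ y ∷ row' ++ s
  bump-knuth p s srt (bump x<c) = shift-left p s _ srt x<c
  bump-knuth p s {x} {c ∷ t} {y} (c≤t ∷ srt) (skip c≤x v) with bumped-head v | insertRow-All v c≤t c≤x
  ... | h , t' , refl , h≤x | c≤h ∷ _ = begin
    p ++ c ∷ t ++ x ∷ s              ≡⟨ ++-assoc p (c ∷ []) _ ⟨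
    (p ++ c ∷ []) ++ t ++ x ∷ s      ≈⟨ bump-knuth (p ++ c ∷ []) s srt v ⟩
    (p ++ c ∷ []) ++ y ∷ h ∷ t' ++ s ≡⟨ ++-assoc p (c ∷ []) _ ⟩
    p ++ c ∷ y ∷ h ∷ t' ++ s         ≈⟨ knuthMove (knuth₂ p (t' ++ s) c≤h (≤-<-trans h≤x (bumped-> v))) ⟩
    p ++ y ∷ c ∷ h ∷ t' ++ s         ∎

  reading-insertT : ∀ x T s → All Sorted T → reading (insertT x T) ++ s ≈ᴷ reading T ++ x ∷ s
  reading-insertT x []           s _          = ≈ᴷ-refl
  reading-insertT x (row ∷ rows) s (sr ∷ srs) with insertRow x row | insertRow-view x row
  ... | nothing , row' | v = begin
    (reading rows ++ row') ++ s             ≡⟨ cong (λ t → (reading rows ++ t) ++ s) (appended v) ⟩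
    (reading rows ++ row ++ x ∷ []) ++ s    ≡⟨ ++-assoc (reading rows) (row ++ x ∷ []) s ⟩
    reading rows ++ (row ++ x ∷ []) ++ s    ≡⟨ cong (reading rows ++_) (++-assoc row (x ∷ []) s) ⟩
    reading rows ++ row ++ x ∷ s            ≡⟨ ++-assoc (reading rows) row (x ∷ s) ⟨
    (reading rows ++ row) ++ x ∷ s          ∎
  ... | just y , row' | v = begin
    (reading (insertT y rows) ++ row') ++ s ≡⟨ ++-assoc (reading (insertT y rows)) row' s ⟩
    reading (insertT y rows) ++ row' ++ s   ≈⟨ reading-insertT y rows (row' ++ s) srs ⟩
    reading rows ++ y ∷ row' ++ s           ≈⟨ bump-knuth (reading rows) s sr v ⟨
    reading rows ++ row ++ x ∷ s            ≡⟨ ++-assoc (reading rows) row (x ∷ s) ⟨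
    (reading rows ++ row) ++ x ∷ s          ∎

  reading-insertAll : ∀ T w → All Sorted T → reading (insertAll T w) ≈ᴷ reading T ++ w
  reading-insertAll T []      _   = begin reading T ≡⟨ ++-identityʳ (reading T) ⟨ reading T ++ [] ∎
  reading-insertAll T (x ∷ w) srt = begin
    reading (insertAll (insertT x T) w) ≈⟨ reading-insertAll (insertT x T) w (insertT-sorted x T srt) ⟩
    reading (insertT x T) ++ w           ≈⟨ reading-insertT x T w srt ⟩
    reading T ++ x ∷ w                   ∎

-- The maximal r-colouring of the reading word of a tableau

sumMin : ℕ → List ℕ → ℕ
sumMin r lam = sum (map (r ⊓_) lam)

DifferentColours : ℕ × ℕ → ℕ × ℕ → Set
DifferentColours (_ , c) (_ , c') = c ≢ 0 → c ≢ c'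

uncolour : ℕ → ℕ → ℕ
uncolour k d with d ≟ k
... | yes _ = 0
... | no _  = d

uncolourAll : ℕ → ColouredWord → ColouredWord
uncolourAll k = map (map₂ (uncolour k))

count-uncolourAll-absent : ∀ k cs → All (λ e → proj₂ e ≢ k) cs → count (uncolourAll k cs) ≡ count cs
count-uncolourAll-absent k []             []           = refl
count-uncolourAll-absent k ((_ , d) ∷ cs) (d≢k ∷ d≢ks) with d ≟ k
... | yes d≡k = ⊥-elim (d≢k d≡k)
... | no _    = cong (weight d +_) (count-uncolourAll-absent k cs d≢ks)

count-uncolourAll : ∀ {k} cs → k ≢ 0 → AllPairs DifferentColours cs →
                    count cs ≤ suc (count (uncolourAll k cs))
count-uncolourAll     []             _   _        = z≤n
count-uncolourAll {k} ((_ , d) ∷ cs) k≢0 (p ∷ ps) with d ≟ k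
... | yes refl rewrite weight-≢0 k≢0 =
  ≤-reflexive (cong suc (sym (count-uncolourAll-absent k cs (All.map (λ d≢d' d≡k → d≢d' k≢0 (sym d≡k)) p))))
... | no _     = ≤-trans (+-monoʳ-≤ (weight d) (count-uncolourAll cs k≢0 ps))
                         (≤-reflexive (+-suc (weight d) _))

uncolourAll-bounded : ∀ r {cs} → Bounded (suc r) cs → Bounded r (uncolourAll (suc r) cs)
uncolourAll-bounded r bs = All.map⁺ (All.map bound bs)
  where
  bound : ∀ {d} → d ≤ suc r → uncolour (suc r) d ≤ r
  bound {d} d≤1+r with d ≟ suc r
  ... | yes _   = z≤n
  ... | no d≢1+r = ≤-pred (≤∧≢⇒< d≤1+r d≢1+r)

uncolourAll-different : ∀ k {cs} → AllPairs DifferentColours cs →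
                        AllPairs DifferentColours (uncolourAll k cs)
uncolourAll-different k ps = AllPairs.map⁺ (AllPairs.map (λ {e} {e'} → different {e} {e'}) ps)
  where
  different : ∀ {e e'} → DifferentColours e e' →
              DifferentColours (map₂ (uncolour k) e) (map₂ (uncolour k) e')
  different {_ , d} {_ , d'} h with d ≟ k | d' ≟ k
  ... | yes _   | _        = λ 0≢0 → ⊥-elim (0≢0 refl)
  ... | no _    | no _     = h
  ... | no _    | yes _    = λ d≢0 d≡0 → d≢0 d≡0

-- Uncolouring the top colour loses at most one letter, as the colours are pairwise different.
pigeonhole : ∀ r cs → Bounded r cs → AllPairs DifferentColours cs → count cs ≤ r
pigeonhole zero    []             _          _        = z≤n
pigeonhole zero    ((_ , 0) ∷ cs) (z≤n ∷ bs) (_ ∷ ps) = pigeonhole zero cs bs ps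
pigeonhole (suc r) cs             bs         ps       =
  ≤-trans (count-uncolourAll cs (λ ()) ps)
          (s≤s (pigeonhole r (uncolourAll (suc r) cs) (uncolourAll-bounded r bs)
                                                      (uncolourAll-different (suc r) ps)))

count≤length : ∀ cs → count cs ≤ length cs
count≤length []              = z≤n
count≤length ((_ , zero) ∷ cs)  = m≤n⇒m≤1+n (count≤length cs)
count≤length ((_ , suc _) ∷ cs) = s≤s (count≤length cs)

sorted-colouring-different : ∀ cs → Sorted (letters cs) → AllPairs _↘_ cs → AllPairs DifferentColours cs
sorted-colouring-different []       _        _        = []
sorted-colouring-different (_ ∷ cs) (p ∷ ps) (q ∷ qs) = different p q ∷ sorted-colouring-different cs ps qs
  where
  different : ∀ {v c xs} → All (v ≤_) (letters xs) → All ((v , c) ↘_) xs →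
              All (DifferentColours (v , c)) xs
  different {xs = []}     []       []       = []
  different {xs = _ ∷ _} (a ∷ as) (b ∷ bs) = (λ c≢0 c≡c' → <⇒≱ (b c≢0 c≡c') a) ∷ different as bs

count-row : ∀ r cs → Bounded r cs → Sorted (letters cs) → AllPairs _↘_ cs → count cs ≤ r ⊓ length cs
count-row r cs bs srt ps =
  ⊓-glb (pigeonhole r cs bs (sorted-colouring-different cs srt ps)) (count≤length cs)

count-reading : ∀ r T → All Sorted T → ∀ cw → IsColouring r cw → letters cw ≡ reading T →
                count cw ≤ sumMin r (map length T)
count-reading r []           _          []  _          _  = z≤n
count-reading r (row ∷ rows) (sr ∷ srs) cw  col eq with letters-++⁻ (reading rows) cw eq
... | cp , cq , refl , eq₁ , refl with isColouring-++⁻ cp col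
...   | colp , (bq , pq) = begin
  count (cp ++ cq)                           ≡⟨ count-++ cp cq ⟩
  count cp + count cq                        ≤⟨ +-mono-≤ (count-reading r rows srs cp colp eq₁)
                                                         (count-row r cq bq sr pq) ⟩
  sumMin r (map length rows) + r ⊓ length cq ≡⟨ +-comm (sumMin r (map length rows)) _ ⟩
  r ⊓ length cq + sumMin r (map length rows) ≡⟨ cong (λ n → r ⊓ n + sumMin r (map length rows))
                                                     (length-map proj₁ cq) ⟨
  sumMin r (map length (letters cq ∷ rows))  ∎
  where open ≤-Reasoning

colourRow : ℕ → ℕ → List ℕ → ColouredWord
colourRow zero    c row      = map (_, 0) row
colourRow (suc b) c []       = []
colourRow (suc b) c (v ∷ row) = (v , c) ∷ colourRow b (suc c) row

-- Column j ≤ r gets colour j; the reading word lists each column bottom-up, hence decreasing.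
colourColumns : ℕ → List (List ℕ) → ColouredWord
colourColumns r []           = []
colourColumns r (row ∷ rows) = colourColumns r rows ++ colourRow r 1 row

letters-colourRow : ∀ b c row → letters (colourRow b c row) ≡ row
letters-colourRow zero    c []        = refl
letters-colourRow zero    c (v ∷ row) = cong (v ∷_) (letters-colourRow zero c row)
letters-colourRow (suc b) c []        = refl
letters-colourRow (suc b) c (v ∷ row) = cong (v ∷_) (letters-colourRow b (suc c) row)

count-colourRow : ∀ b c row → count (colourRow b (suc c) row) ≡ b ⊓ length row
count-colourRow zero    c []        = refl
count-colourRow zero    c (_ ∷ row) = count-colourRow zero c row
count-colourRow (suc b) c []        = refl
count-colourRow (suc b) c (_ ∷ row) = cong suc (count-colourRow b (suc c) row)

colourRow-bounded : ∀ r b c row → c + b ≤ suc r → Bounded r (colourRow b c row)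
colourRow-bounded r zero    c []        _ = []
colourRow-bounded r zero    c (_ ∷ row) h = z≤n ∷ colourRow-bounded r zero c row h
colourRow-bounded r (suc b) c []        _ = []
colourRow-bounded r (suc b) c (_ ∷ row) h =
  ≤-pred (≤-trans (s≤s (m≤m+n c b)) h') ∷ colourRow-bounded r b (suc c) row h'
  where
  h' : suc c + b ≤ suc r
  h' = subst (_≤ suc r) (+-suc c b) h

FreshColour : ℕ → ℕ × ℕ → Set
FreshColour c (_ , d) = d ≡ 0 ⊎ c < d

colourRow-fresh : ∀ b c row → All (FreshColour c) (colourRow b (suc c) row)
colourRow-fresh zero    c []        = []
colourRow-fresh zero    c (_ ∷ row) = inj₁ refl ∷ colourRow-fresh zero c row
colourRow-fresh (suc b) c []        = []
colourRow-fresh (suc b) c (_ ∷ row) =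
  inj₂ ≤-refl ∷ All.map (Sum.map₂ (<-trans (n<1+n c))) (colourRow-fresh b (suc c) row)

↘-fresh : ∀ {v c e} → FreshColour c e → (v , c) ↘ e
↘-fresh (inj₁ refl) = ↘-to-uncoloured _
↘-fresh (inj₂ c<d)  = ↘-different (<⇒≢ c<d)

fresh-↘ : ∀ {v c e} → FreshColour c e → e ↘ (v , c)
fresh-↘ (inj₁ refl) = ↘-from-uncoloured _
fresh-↘ (inj₂ c<d)  = ↘-different (≢-sym (<⇒≢ c<d))

colourRow-colouring : ∀ b c row → AllPairs _↘_ (colourRow b c row)
colourRow-colouring zero    c []        = []
colourRow-colouring zero    c (_ ∷ row) =
  All.universal ↘-from-uncoloured _ ∷ colourRow-colouring zero c row
colourRow-colouring (suc b) c []        = []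
colourRow-colouring (suc b) c (_ ∷ row) =
  All.map ↘-fresh (colourRow-fresh b c row) ∷ colourRow-colouring b (suc c) row

colourRow-below : ∀ {u l} → ColumnStrict u l → ∀ b c →
                  All (λ e → All (e ↘_) (colourRow b c u)) (colourRow b c l)
colourRow-below {l = l} _ zero c = All.map⁺ (All.universal (λ _ → All.universal ↘-from-uncoloured _) l)
colourRow-below []                          (suc b) c = []
colourRow-below {_ ∷ u} {_ ∷ l} (a<v ∷ cs) (suc b) c =
  ((λ _ _ → a<v) ∷ All.map ↘-fresh (colourRow-fresh b c u))
  ∷ All.zipWith (λ { (fresh , below) → fresh-↘ fresh ∷ below })
                (colourRow-fresh b c l , colourRow-below cs b (suc c))

colourColumns-colouring : ∀ r T → Linked ColumnStrict T → IsColouring r (colourColumns r T)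
colourColumns-colouring r []           _  = [] , []
colourColumns-colouring r (row ∷ rows) lk with colourColumns-colouring r rows (Linked.tail lk)
... | bs , ps = All.++⁺ bs (colourRow-bounded r r 1 row ≤-refl) ,
                AllPairs.++⁺ ps (colourRow-colouring r 1 row) (below rows (columnStrict-below lk))
  where
  below : ∀ rows → All (ColumnStrict row) rows →
          All (λ e → All (e ↘_) (colourRow r 1 row)) (colourColumns r rows)
  below []             []         = []
  below (row' ∷ rows') (cs ∷ css) = All.++⁺ (below rows' css) (colourRow-below cs r 1)

letters-colourColumns : ∀ r T → letters (colourColumns r T) ≡ reading T
letters-colourColumns r []           = refl
letters-colourColumns r (row ∷ rows) =
  trans (map-++ proj₁ (colourColumns r rows) _)
        (cong₂ _++_ (letters-colourColumns r rows) (letters-colourRow r 1 row))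

count-colourColumns : ∀ r T → count (colourColumns r T) ≡ sumMin r (map length T)
count-colourColumns r []           = refl
count-colourColumns r (row ∷ rows) = begin
  count (colourColumns r rows ++ colourRow r 1 row)        ≡⟨ count-++ (colourColumns r rows) _ ⟩
  count (colourColumns r rows) + count (colourRow r 1 row) ≡⟨ cong₂ _+_ (count-colourColumns r rows)
                                                                       (count-colourRow r 0 row) ⟩
  sumMin r (map length rows) + r ⊓ length row              ≡⟨ +-comm (sumMin r (map length rows)) _ ⟩
  r ⊓ length row + sumMin r (map length rows)              ∎
  where open ≡-Reasoning

maxColouring-reading : ∀ r T → Tableau T → MaxColouring r (reading T) (sumMin r (map length T))
maxColouring-reading r T (srt , lk) =
  (colourColumns r T , colourColumns-colouring r T lk , letters-colourColumns r T , count-colourColumns r T) ,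
  λ { (cw , col , eq , refl) → count-reading r T srt cw col eq }

greene : ∀ r w → MaxColouring r w (sumMin r (shape w))
greene r w = maxColouring-≈ᴷ (reading-insertAll [] w [])
                             (maxColouring-reading r (insertionTableau w) (insertAll-tableau [] w ([] , [])))

-- Conjugate partitions

conj-∷ : ∀ x lam k → conj (x ∷ lam) k ≡ conj (x ∷ []) k + conj lam k
conj-∷ x lam k with Nat._≤ᵇ_ k x
... | true  = refl
... | false = refl

conj-singleton-suc : ∀ x k → conj (suc x ∷ []) (suc (suc k)) ≡ conj (x ∷ []) (suc k)
conj-singleton-suc x k with Nat._<ᵇ_ k x
... | true  = refl
... | false = refl

applyUpTo-cong : ∀ {A : Set} {f g : ℕ → A} r → (∀ k → f k ≡ g k) → applyUpTo f r ≡ applyUpTo g r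
applyUpTo-cong zero    _   = refl
applyUpTo-cong (suc r) f≗g = cong₂ _∷_ (f≗g 0) (applyUpTo-cong r (λ k → f≗g (suc k)))

conj-singleton-sum : ∀ x r → sum (applyUpTo (λ k → conj (x ∷ []) (suc k)) r) ≡ r ⊓ x
conj-singleton-sum x       zero    = refl
conj-singleton-sum zero    (suc r) = trans (conj-singleton-sum zero r) (⊓-zeroʳ r)
conj-singleton-sum (suc x) (suc r) =
  cong suc (trans (cong sum (applyUpTo-cong r (conj-singleton-suc x))) (conj-singleton-sum x r))

sum-map-+ : ∀ (f g : ℕ → ℕ) ks → sum (map (λ k → f k + g k) ks) ≡ sum (map f ks) + sum (map g ks)
sum-map-+ f g []       = refl
sum-map-+ f g (k ∷ ks) =
  trans (cong (f k + g k +_) (sum-map-+ f g ks)) (interchange (f k) (g k) (sum (map f ks)) (sum (map g ks)))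

conjSum-sumMin : ∀ lam r → conjSum lam r ≡ sumMin r lam
conjSum-sumMin []        r = sum-zero (upTo r)
  where
  sum-zero : ∀ ks → sum (map (conj []) (map suc ks)) ≡ 0
  sum-zero []       = refl
  sum-zero (_ ∷ ks) = sum-zero ks
conjSum-sumMin (x ∷ lam) r = begin
  sum (map (conj (x ∷ lam)) ks)                                 ≡⟨ cong sum (map-cong (conj-∷ x lam) ks) ⟩
  sum (map (λ k → conj (x ∷ []) k + conj lam k) ks)             ≡⟨ sum-map-+ (conj (x ∷ [])) (conj lam) ks ⟩
  sum (map (conj (x ∷ [])) ks) + conjSum lam r                  ≡⟨ cong (_+ conjSum lam r) column-sum ⟩
  r ⊓ x + conjSum lam r                                         ≡⟨ cong (r ⊓ x +_) (conjSum-sumMin lam r) ⟩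
  r ⊓ x + sumMin r lam                                          ∎
  where
  open ≡-Reasoning
  ks = range 1 r
  column-sum : sum (map (conj (x ∷ [])) ks) ≡ r ⊓ x
  column-sum = begin
    sum (map (conj (x ∷ [])) (map suc (upTo r)))                 ≡⟨ cong sum (map-∘ (upTo r)) ⟨
    sum (map (λ k → conj (x ∷ []) (suc k)) (upTo r))             ≡⟨ cong sum (map-applyUpTo id _ r) ⟩
    sum (applyUpTo (λ k → conj (x ∷ []) (suc k)) r)              ≡⟨ conj-singleton-sum x r ⟩
    r ⊓ x                                                        ∎

-- Nestings of P and decreasing subsequences of α(P)

-- The order in which arcs n f lists the arcs.
Lex : ℕ × ℕ → ℕ × ℕ → Set
Lex (a , b) (c , d) = b < d ⊎ (b ≡ d × a < c)

Lex-≢ : ∀ {e e'} → Lex e e' → e ≢ e'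
Lex-≢ (inj₁ b<b)       refl = <-irrefl refl b<b
Lex-≢ (inj₂ (_ , a<a)) refl = <-irrefl refl a<a

nested⇒descent : ∀ {a b c d} → Lex (a , b) (c , d) → Nested (a , b) (c , d) → c < a
nested⇒descent _                 (inj₂ (c<a , _))   = c<a
nested⇒descent (inj₁ b<d)        (inj₁ (_ , _ , d<b)) = ⊥-elim (<-asym b<d d<b)
nested⇒descent (inj₂ (refl , _)) (inj₁ (_ , _ , d<b)) = ⊥-elim (<-irrefl refl d<b)

descent⇒nested : ∀ {a b c d} → a < b → Lex (a , b) (c , d) → c < a → Nested (a , b) (c , d)
descent⇒nested a<b (inj₁ b<d)       c<a = inj₂ (c<a , a<b , b<d)
descent⇒nested _   (inj₂ (_ , a<c)) c<a = ⊥-elim (<-asym a<c c<a)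

nested-sym : ∀ {a b c d} → Nested (a , b) (c , d) → Nested (c , d) (a , b)
nested-sym = Sum.swap

arc-< : ∀ {n f a b} → IsArc n f (a , b) → a < b
arc-< {a = a} {b} isArc =
  <ᵇ⇒< a b (proj₁ (to (T-∧ {a <ᵇ b}) (proj₂ (to (T-∧ {1 ≤ᵇ a}) (from T-≡ isArc)))))
  where open Equivalence

range-increasing : ∀ n → AllPairs _<_ (range 1 n)
range-increasing n = AllPairs.map⁺ (AllPairs.applyUpTo⁺₁ id n (λ i<j _ → s≤s i<j))

arcsEndingAt : ℕ → (ℕ → ℕ) → ℕ → List (ℕ × ℕ)
arcsEndingAt n f b = map (_, b) (filter (λ a → T? (isArc n f a b)) (range 1 n))

arcs-isArc : ∀ n f → All (IsArc n f) (arcs n f)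
arcs-isArc n f = All.concat⁺ (All.map⁺ (All.universal ending (range 1 n)))
  where
  ending : ∀ b → All (IsArc n f) (arcsEndingAt n f b)
  ending b = All.map⁺ (All.map (Equivalence.to T-≡) (All.all-filter (λ a → T? (isArc n f a b)) (range 1 n)))

arcs-sorted : ∀ n f → AllPairs Lex (arcs n f)
arcs-sorted n f = AllPairs.concat⁺ (All.map⁺ (All.universal ending-sorted (range 1 n)))
                                    (AllPairs.map⁺ (AllPairs.map endings-sorted (range-increasing n)))
  where
  ending-sorted : ∀ b → AllPairs Lex (arcsEndingAt n f b)
  ending-sorted b = AllPairs.map⁺ (AllPairs.map (λ a<c → inj₂ (refl , a<c))
                                                (AllPairs.filter⁺ (λ a → T? (isArc n f a b)) (range-increasing n)))
  endings-sorted : ∀ {b b'} → b < b' → All (λ e → All (Lex e) (arcsEndingAt n f b')) (arcsEndingAt n f b)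
  endings-sorted b<b' = All.map⁺ (All.universal (λ _ → All.map⁺ (All.universal (λ _ → inj₁ b<b') _)) _)

AllPairs-with : ∀ {A : Set} {P : A → Set} {R : Rel A 0ℓ} {xs} → All P xs → AllPairs R xs →
                AllPairs (λ x y → P x × P y × R x y) xs
AllPairs-with []       []       = []
AllPairs-with (p ∷ ps) (r ∷ rs) = All.zipWith (λ (p' , r') → p , p' , r') (ps , r) ∷ AllPairs-with ps rs

colourBy : (ℕ × ℕ → ℕ) → List (ℕ × ℕ) → ColouredWord
colourBy col = map (λ e → proj₁ e , col e)

letters-colourBy : ∀ col A → letters (colourBy col A) ≡ map proj₁ A
letters-colourBy col A = sym (map-∘ A)

count-colourBy : ∀ (col : ℕ × ℕ → ℕ) (P : ℕ × ℕ → Bool) A → (∀ e → col e ≢ 0 ⇔ T (P e)) →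
                 count (colourBy col A) ≡ length (filter (λ e → T? (P e)) A)
count-colourBy col P []      _ = refl
count-colourBy col P (e ∷ A) h with col e | P e | h e
... | zero  | false | _   = count-colourBy col P A h
... | zero  | true  | c⇔P = ⊥-elim (Equivalence.from c⇔P tt refl)
... | suc _ | true  | _   = cong suc (count-colourBy col P A h)
... | suc _ | false | c⇔P = ⊥-elim (Equivalence.to c⇔P (λ ()))

memberColour : ∀ {r} → Family r → ℕ × ℕ → ℕ
memberColour S e with Fin.any? (λ i → T? (S i e))
... | yes (i , _) = suc (toℕ i)
... | no _        = 0

data MemberView {r} (S : Family r) (e : ℕ × ℕ) : ℕ → Set where
  member : ∀ i → T (S i e) → MemberView S e (suc (toℕ i))
  none   : (∀ i → ¬ T (S i e)) → MemberView S e 0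

memberView : ∀ {r} (S : Family r) e → MemberView S e (memberColour S e)
memberView S e with Fin.any? (λ i → T? (S i e))
... | yes (i , t) = member i t
... | no ¬∃       = none (λ i t → ¬∃ (i , t))

memberColour-≤ : ∀ {r} (S : Family r) e → memberColour S e ≤ r
memberColour-≤ S e with memberColour S e | memberView S e
... | _ | member i _ = toℕ<n i
... | _ | none _     = z≤n

memberColour⇔any : ∀ {r} (S : Family r) e → memberColour S e ≢ 0 ⇔ T (any (λ i → S i e) (allFin _))
memberColour⇔any S e with memberColour S e | memberView S e
... | _ | member i t = mk⇔ (λ _ → any⁺ _ (lose (∈-allFin i) t)) (λ _ ())
... | _ | none ¬t    =
  mk⇔ (λ 0≢0 → ⊥-elim (0≢0 refl)) (λ t → ⊥-elim (uncurry ¬t (Any.satisfied (any⁻ _ (allFin _) t))))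

nestingFamily⇒colouring : ∀ n f r (S : Family r) → IsNestingFamily n f r S →
                          HasColouring r (alpha n f) (unionSize n f r S)
nestingFamily⇒colouring n f r S nesting =
  colourBy col A ,
  (All.map⁺ (All.universal (memberColour-≤ S) A) ,
   AllPairs.map⁺ (AllPairs.map descends (AllPairs-with (arcs-isArc n f) (arcs-sorted n f)))) ,
  letters-colourBy col A , count-colourBy col _ A (memberColour⇔any S)
  where
  open Equivalence
  A = arcs n f
  col = memberColour S
  descends : ∀ {e e'} → IsArc n f e × IsArc n f e' × Lex e e' → (proj₁ e , col e) ↘ (proj₁ e' , col e')
  descends {e@(a , b)} {e'@(c , d)} (arc , arc' , lex)
    with col e | memberView S e | col e' | memberView S e'
  ... | _ | none _     | _ | _            = ↘-from-uncoloured _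
  ... | _ | member _ _ | _ | none _       = λ _ ()
  ... | _ | member i t | _ | member i' t' = λ _ i≡i' →
    let i'≡i = sym (toℕ-injective (suc-injective i≡i'))
    in nested⇒descent lex
         (nesting i e e' arc arc' (to T-≡ t) (to T-≡ (subst (λ j → T (S j e')) i'≡i t')) (Lex-≢ lex))

_≟ᵃ_ : DecidableEquality (ℕ × ℕ)
_≟ᵃ_ = ≡-dec _≟_ _≟_

colourOf : ColouredWord → List (ℕ × ℕ) → ℕ × ℕ → ℕ
colourOf []             _        _ = 0
colourOf (_ ∷ _)        []       _ = 0
colourOf ((_ , c) ∷ cw) (e' ∷ A) e with e ≟ᵃ e'
... | yes _ = c
... | no _  = colourOf cw A e

colourOf-∈ : ∀ cw A e → colourOf cw A e ≢ 0 → e ∈ A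
colourOf-∈ []             _        _ c≢0 = ⊥-elim (c≢0 refl)
colourOf-∈ (_ ∷ _)        []       _ c≢0 = ⊥-elim (c≢0 refl)
colourOf-∈ ((_ , c) ∷ cw) (e' ∷ A) e c≢0 with e ≟ᵃ e'
... | yes e≡e' = Any.here e≡e'
... | no _     = Any.there (colourOf-∈ cw A e c≢0)

colourOf-≤ : ∀ {r} cw A e → Bounded r cw → colourOf cw A e ≤ r
colourOf-≤ []             _        _ _        = z≤n
colourOf-≤ (_ ∷ _)        []       _ _        = z≤n
colourOf-≤ ((_ , c) ∷ cw) (e' ∷ A) e (b ∷ bs) with e ≟ᵃ e'
... | yes _ = b
... | no _  = colourOf-≤ cw A e bs

colourBy-colourOf : ∀ cw A → letters cw ≡ map proj₁ A → AllPairs _≢_ A → colourBy (colourOf cw A) A ≡ cw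
colourBy-colourOf []             []      _  _                 = refl
colourBy-colourOf ((v , c) ∷ cw) (e ∷ A) eq (e∉A ∷ distinct) with ∷-injective eq
... | refl , eq' =
  cong₂ _∷_ (cong (v ,_) colour-here)
            (trans (map-cong-local (All.map (λ {e'} e≢e' → cong (proj₁ e' ,_) (colour-there e≢e')) e∉A))
                   (colourBy-colourOf cw A eq' distinct))
  where
  colour-here : colourOf ((v , c) ∷ cw) (e ∷ A) e ≡ c
  colour-here with e ≟ᵃ e
  ... | yes _  = refl
  ... | no e≢e = ⊥-elim (e≢e refl)
  colour-there : ∀ {e'} → e ≢ e' → colourOf ((v , c) ∷ cw) (e ∷ A) e' ≡ colourOf cw A e'
  colour-there {e'} e≢e' with e' ≟ᵃ e
  ... | yes e'≡e = ⊥-elim (e≢e' (sym e'≡e))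
  ... | no _     = refl

nonzero⇔any : ∀ {r c} → c ≤ r → c ≢ 0 ⇔ T (any (λ i → c ≡ᵇ suc (toℕ i)) (allFin r))
nonzero⇔any {r} {zero}  _   =
  mk⇔ (λ 0≢0 → ⊥-elim (0≢0 refl)) (λ t → ⊥-elim (impossible (Any.satisfied (any⁻ _ (allFin r) t))))
  where
  impossible : ∃ (λ i → T (0 ≡ᵇ suc (toℕ i))) → ⊥
  impossible (_ , ())
nonzero⇔any {r} {suc k} k<r = mk⇔ (λ _ → any⁺ _ (lose (∈-allFin (fromℕ< k<r)) hit)) (λ _ ())
  where
  hit : T (suc k ≡ᵇ suc (toℕ (fromℕ< k<r)))
  hit = ≡⇒≡ᵇ k _ (sym (toℕ-fromℕ< k<r))

colouring⇒nestingFamily : ∀ n f r {k} → HasColouring r (alpha n f) k →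
                          Σ (Family r) λ S → IsNestingFamily n f r S × unionSize n f r S ≡ k
colouring⇒nestingFamily n f r (cw , (bs , ps) , eq , refl) = S , nesting , count-eq
  where
  A = arcs n f
  col = colourOf cw A
  colourBy≡cw : colourBy col A ≡ cw
  colourBy≡cw = colourBy-colourOf cw A eq (AllPairs.map Lex-≢ (arcs-sorted n f))
  S : Family r
  S i e = col e ≡ᵇ suc (toℕ i)
  coloured : ∀ {i e} → S i e ≡ true → col e ≡ suc (toℕ i)
  coloured Sie = ≡ᵇ⇒≡ _ _ (Equivalence.from T-≡ Sie)
  coloured≢0 : ∀ {i e} → S i e ≡ true → col e ≢ 0
  coloured≢0 Sie ce≡0 = 0≢1+n (trans (sym ce≡0) (coloured Sie))
  sameColour : ∀ {i e e'} → S i e ≡ true → S i e' ≡ true → col e ≡ col e'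
  sameColour Sie Sie' = trans (coloured Sie) (sym (coloured Sie'))
  ordered : AllPairs (λ e e' → Lex e e' × (proj₁ e , col e) ↘ (proj₁ e' , col e')) A
  ordered = AllPairs.zip (arcs-sorted n f , AllPairs.map⁻ (subst (AllPairs _↘_) (sym colourBy≡cw) ps))
  nesting : IsNestingFamily n f r S
  nesting i (a , b) (c , d) arc arc' Se Se' e≢e'
    with ∈-AllPairs₂ ordered (colourOf-∈ cw A _ (coloured≢0 Se)) (colourOf-∈ cw A _ (coloured≢0 Se'))
  ... | inj₁ e≡e'               = ⊥-elim (e≢e' e≡e')
  ... | inj₂ (inj₁ (lex , ↘e')) =
    descent⇒nested (arc-< {n} {f} arc) lex (↘e' (coloured≢0 Se) (sameColour Se Se'))
  ... | inj₂ (inj₂ (lex , ↘e))  =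
    nested-sym (descent⇒nested (arc-< {n} {f} arc') lex (↘e (coloured≢0 Se') (sameColour Se' Se)))
  count-eq : unionSize n f r S ≡ count cw
  count-eq = sym (trans (cong count (sym colourBy≡cw))
                        (count-colourBy col _ A (λ e → nonzero⇔any (colourOf-≤ cw A e bs))))

maxColouring⇒ne : ∀ n f r {m} → MaxColouring r (alpha n f) m → IsNe n f r m
maxColouring⇒ne n f r (attained , bounded) =
  colouring⇒nestingFamily n f r attained , λ S nesting → bounded (nestingFamily⇒colouring n f r S nesting)

corollary9 : (n : ℕ) (f : ℕ → ℕ) (r : ℕ) → 1 ≤ r →
    IsNe n f r (conjSum (shape (alpha n f)) r)
corollary9 n f r _ =
  subst (IsNe n f r) (sym (conjSum-sumMin (shape (alpha n f)) r))
        (maxColouring⇒ne n f r (greene r (alpha n f)))
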